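{- Let $N\geq 3$ be an integer and let $p$ be a prime with $3N<p<6N$. If $S\subseteq[N/3]$ is non-empty, then $\Lambda_S(1_{[N]})>\frac{1}{18}$.
   Context: $[X]=\{n\in\mathbb{N}:1\le n\le X\}$. The interval $[N]$ is regarded as a subset of $\mathbb{Z}/p\mathbb{Z}$ by reduction modulo $p$, and $1_{[N]}:\mathbb{Z}/p\mathbb{Z}\to\{0,1\}$ is its indicator function. For non-empty $S\subseteq\mathbb{Z}/p\mathbb{Z}$ and $f_1,f_2,f_3:\mathbb{Z}/p\mathbb{Z}\to\mathbb{C}$, $\Lambda_S(f_1,f_2,f_3)=\mathbb{E}_{x\in\mathbb{Z}/p\mathbb{Z}}\mathbb{E}_{d\in S}f_1(x)f_2(x+d)f_3(x+2d)$, where $\mathbb{E}_{y\in Y}$ denotes the average over the finite set $Y$, and $\Lambda_S(f)=\Lambda_S(f,f,f)$. -}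

module Defs where

open import Data.Nat using (ℕ; zero; suc; NonZero; _≤?_)
import Data.Nat as ℕ
open import Data.Nat.DivMod using (_mod_)
open import Data.Fin using (Fin; toℕ)
open import Data.Fin.Subset using (Subset; ∣_∣)
open import Data.Vec using (lookup)
open import Data.Bool using (Bool; true; false; if_then_else_)
open import Data.Integer using (+_)
open import Data.Rational using (ℚ; 0ℚ; 1ℚ; _+_; _*_; _/_)
open import Relation.Nullary.Decidable using (⌊_⌋)
open import Data.Bool using (_∧_)

-- ℤ/pℤ is modelled as Fin p, with addition modulo p.
infixl 6 _+ₚ_
_+ₚ_ : {p : ℕ} .{{_ : NonZero p}} → Fin p → Fin p → Fin p
_+ₚ_ {p} x y = (toℕ x ℕ.+ toℕ y) mod p

sumFin : (n : ℕ) → (Fin n → ℚ) → ℚ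
sumFin zero    f = 0ℚ
sumFin (suc n) f = f Fin.zero + sumFin n (λ i → f (Fin.suc i))
  where import Data.Fin as Fin

-- (1/k) * s, with the convention 0 when k = 0 (never used: sets are non-empty)
scale : ℕ → ℚ → ℚ
scale zero    s = 0ℚ
scale (suc k) s = s * (+ 1 / suc k)

𝔼all : (p : ℕ) → (Fin p → ℚ) → ℚ
𝔼all p f = scale p (sumFin p f)

𝔼sub : {p : ℕ} → Subset p → (Fin p → ℚ) → ℚ
𝔼sub {p} S f = scale ∣ S ∣ (sumFin p (λ d → if lookup S d then f d else 0ℚ))

Λ : {p : ℕ} .{{_ : NonZero p}} → Subset p →
    (Fin p → ℚ) → (Fin p → ℚ) → (Fin p → ℚ) → ℚ
Λ {p} S f₁ f₂ f₃ =
  𝔼all p (λ x → 𝔼sub S (λ d → f₁ x * f₂ (x +ₚ d) * f₃ ((x +ₚ d) +ₚ d)))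

Λ₁ : {p : ℕ} .{{_ : NonZero p}} → Subset p → (Fin p → ℚ) → ℚ
Λ₁ S f = Λ S f f f

-- indicator of [N] = {1,…,N} reduced mod p, as a function on ℤ/pℤ.
-- (Valid description when N < p: then reduction is injective on [N] and
--  x ∈ [N] mod p  iff its representative toℕ x ∈ {1,…,N}.)
1[_] : {p : ℕ} → ℕ → Fin p → ℚ
1[ N ] x = if ⌊ 1 ≤? toℕ x ⌋ ∧ ⌊ toℕ x ≤? N ⌋ then 1ℚ else 0ℚ

-- With q = ⌊N/3⌋ and M = N − 2q ≥ N/3: for 1 ≤ x ≤ M and 0 < d ≤ q the progression
-- x, x + d, x + 2d stays inside [N] ⊆ [0, p) with no wrap-around modulo p, so the inner
-- average over d ∈ S equals 1 at these M values of x, and it is nonnegative elsewhere.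
-- Hence Λ_S(1_[N]) ≥ M/p > 1/18, because p < 6N ≤ 18M.
module Submission where

open import Defs
open import Data.Nat using (ℕ; NonZero; _≤_; _<_; _*_)
open import Data.Nat.Primality using (Prime)
open import Data.Fin using (toℕ)
open import Data.Fin.Subset using (Subset; _∈_; Nonempty)
open import Data.Product using (_×_)
open import Data.Integer using (+_)
open import Data.Rational using (_/_)
import Data.Rational as ℚ

open import Data.Bool using (true; false; if_then_else_)
open import Data.Fin using (Fin) renaming (zero to fzero; suc to fsuc)
open import Data.Fin.Properties using (toℕ-fromℕ<)
open import Data.Fin.Subset using (∣_∣)
open import Data.Fin.Subset.Properties using (p∩q≢∅⇒∣p─q∣<∣p∣; x∈p∩q⁺)
import Data.Integer as ℤ
import Data.Integer.Properties as ℤP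
open import Data.Integer.Tactic.RingSolver using (solve-∀)
open import Data.Nat as ℕ using (zero; suc; z≤n; s≤s; _≤?_)
open import Data.Nat.DivMod using (_%_; m<n⇒m%n≡m; m≡m%n+[m/n]*n; m*n/n≡m; /-monoˡ-≤)
import Data.Nat.Properties as ℕP
open import Data.Nat.Tactic.RingSolver using () renaming (solve-∀ to ℕ-solve-∀)
open import Data.Product using (_,_; proj₂)
open import Data.Rational using (ℚ; 0ℚ; 1ℚ; toℚᵘ)
import Data.Rational.Properties as ℚP
open import Data.Rational.Unnormalised as ℚᵘ using (mkℚᵘ; *≡*; *<*)
import Data.Rational.Unnormalised.Properties as ℚᵘP
open import Data.Vec using (_∷_; []; lookup)
open import Data.Vec.Properties using (lookup⇒[]=)
open import Relation.Binary.PropositionalEquality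
open import Relation.Nullary using (yes; no)
open import Relation.Nullary.Negation using (contradiction)

ι : ℕ → ℚ
ι n = + n / 1

toℚᵘ-/ : ∀ m k → toℚᵘ (+ m / suc k) ℚᵘ.≃ mkℚᵘ (+ m) k
toℚᵘ-/ m k = ℚP.toℚᵘ-fromℚᵘ (mkℚᵘ (+ m) k)

ι-+ : ∀ m n → ι (m ℕ.+ n) ≡ ι m ℚ.+ ι n
ι-+ m n = ℚP.toℚᵘ-injective (begin
  toℚᵘ (ι (m ℕ.+ n))              ≈⟨ toℚᵘ-/ (m ℕ.+ n) 0 ⟩
  mkℚᵘ (+ (m ℕ.+ n)) 0            ≈⟨ *≡* (trans (cong (ℤ._* + 1) (ℤP.pos-+ m n)) (lem (+ m) (+ n))) ⟩
  mkℚᵘ (+ m) 0 ℚᵘ.+ mkℚᵘ (+ n) 0  ≈⟨ ℚᵘP.+-cong (toℚᵘ-/ m 0) (toℚᵘ-/ n 0) ⟨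
  toℚᵘ (ι m) ℚᵘ.+ toℚᵘ (ι n)      ≈⟨ ℚP.toℚᵘ-homo-+ (ι m) (ι n) ⟨
  toℚᵘ (ι m ℚ.+ ι n)              ∎)
  where
  open ℚᵘP.≃-Reasoning
  lem : ∀ a b → (a ℤ.+ b) ℤ.* + 1 ≡ (a ℤ.* + 1 ℤ.+ b ℤ.* + 1) ℤ.* + 1
  lem = solve-∀

ι*1/ : ∀ m k → ι m ℚ.* (+ 1 / suc k) ≡ + m / suc k
ι*1/ m k = ℚP.toℚᵘ-injective (begin
  toℚᵘ (ι m ℚ.* (+ 1 / suc k))        ≈⟨ ℚP.toℚᵘ-homo-* (ι m) (+ 1 / suc k) ⟩
  toℚᵘ (ι m) ℚᵘ.* toℚᵘ (+ 1 / suc k)  ≈⟨ ℚᵘP.*-cong (toℚᵘ-/ m 0) (toℚᵘ-/ 1 k) ⟩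
  mkℚᵘ (+ m) 0 ℚᵘ.* mkℚᵘ (+ 1) k      ≈⟨ *≡* (lem (+ m) (+ suc k)) ⟩
  mkℚᵘ (+ m) k                        ≈⟨ toℚᵘ-/ m k ⟨
  toℚᵘ (+ m / suc k)                  ∎)
  where
  open ℚᵘP.≃-Reasoning
  lem : ∀ a b → (a ℤ.* + 1) ℤ.* b ≡ a ℤ.* (+ 1 ℤ.* b)
  lem = solve-∀

n/n≡1 : ∀ k → + suc k / suc k ≡ 1ℚ
n/n≡1 k = ℚP.toℚᵘ-injective (ℚᵘP.≃-trans (toℚᵘ-/ (suc k) k) (*≡* (ℤP.*-comm (+ suc k) (+ 1))))

1/a<m/n : ∀ a m k → suc k < suc a * m → + 1 / suc a ℚ.< + m / suc k
1/a<m/n a m k n<am = ℚP.toℚᵘ-cancel-< (ℚᵘP.<-respˡ-≃ (ℚᵘP.≃-sym (toℚᵘ-/ 1 a))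
  (ℚᵘP.<-respʳ-≃ (ℚᵘP.≃-sym (toℚᵘ-/ m k)) (*<* (subst₂ ℤ._<_
    (sym (ℤP.*-identityˡ (+ suc k))) (ℤP.pos-* m (suc a))
    (ℤ.+<+ (subst (suc k <_) (ℕP.*-comm (suc a) m) n<am))))))

*-nonNeg : ∀ {a b} → 0ℚ ℚ.≤ a → 0ℚ ℚ.≤ b → 0ℚ ℚ.≤ a ℚ.* b
*-nonNeg {a} {b} 0≤a 0≤b = ℚP.nonNegative⁻¹ (a ℚ.* b)
  {{ℚP.nonNeg*nonNeg⇒nonNeg a {{ℚ.nonNegative 0≤a}} b {{ℚ.nonNegative 0≤b}}}}

sumFin-mono : ∀ n {f g : Fin n → ℚ} → (∀ i → f i ℚ.≤ g i) → sumFin n f ℚ.≤ sumFin n g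
sumFin-mono zero    f≤g = ℚP.≤-refl
sumFin-mono (suc n) f≤g = ℚP.+-mono-≤ (f≤g fzero) (sumFin-mono n (λ i → f≤g (fsuc i)))

sumFin-nonNeg : ∀ n {f : Fin n → ℚ} → (∀ i → 0ℚ ℚ.≤ f i) → 0ℚ ℚ.≤ sumFin n f
sumFin-nonNeg zero    0≤f = ℚP.≤-refl
sumFin-nonNeg (suc n) 0≤f = ℚP.+-mono-≤ (0≤f fzero) (sumFin-nonNeg n (λ i → 0≤f (fsuc i)))

sumFin-≥-interval : ∀ n lo m {f : Fin n → ℚ} → (∀ i → 0ℚ ℚ.≤ f i) →
  (∀ i → lo ≤ toℕ i → toℕ i < lo ℕ.+ m → 1ℚ ℚ.≤ f i) → lo ℕ.+ m ≤ n → ι m ℚ.≤ sumFin n f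
sumFin-≥-interval n       zero     zero        0≤f _    _           = sumFin-nonNeg n 0≤f
sumFin-≥-interval (suc n) (suc lo) m       {f} 0≤f 1≤f (s≤s lo+m≤n) =
  subst (ℚ._≤ sumFin (suc n) f) (ℚP.+-identityˡ (ι m))
    (ℚP.+-mono-≤ (0≤f fzero)
      (sumFin-≥-interval n lo m (λ i → 0≤f (fsuc i))
        (λ i lo≤i i<lo+m → 1≤f (fsuc i) (s≤s lo≤i) (s≤s i<lo+m)) lo+m≤n))
sumFin-≥-interval (suc n) zero     (suc m) {f} 0≤f 1≤f (s≤s m≤n)    =
  subst (ℚ._≤ sumFin (suc n) f) (sym (ι-+ 1 m))
    (ℚP.+-mono-≤ (1≤f fzero z≤n (s≤s z≤n))
      (sumFin-≥-interval n zero m (λ i → 0≤f (fsuc i))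
        (λ i _ i<m → 1≤f (fsuc i) z≤n (s≤s i<m)) m≤n))

sumFin-restrict-const : ∀ {n} (S : Subset n) c →
  sumFin n (λ d → if lookup S d then c else 0ℚ) ≡ c ℚ.* ι ∣ S ∣
sumFin-restrict-const []          c = sym (ℚP.*-zeroʳ c)
sumFin-restrict-const (false ∷ S) c = trans (ℚP.+-identityˡ _) (sumFin-restrict-const S c)
sumFin-restrict-const (true ∷ S)  c = begin
  c ℚ.+ sumFin _ (λ d → if lookup S d then c else 0ℚ)  ≡⟨ cong (c ℚ.+_) (sumFin-restrict-const S c) ⟩
  c ℚ.+ c ℚ.* ι ∣ S ∣                                  ≡⟨ cong (ℚ._+ c ℚ.* ι ∣ S ∣) (sym (ℚP.*-identityʳ c)) ⟩
  c ℚ.* 1ℚ ℚ.+ c ℚ.* ι ∣ S ∣                           ≡⟨ sym (ℚP.*-distribˡ-+ c 1ℚ (ι ∣ S ∣)) ⟩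
  c ℚ.* (1ℚ ℚ.+ ι ∣ S ∣)                               ≡⟨ cong (c ℚ.*_) (sym (ι-+ 1 ∣ S ∣)) ⟩
  c ℚ.* ι (suc ∣ S ∣)                                  ∎
  where open ≡-Reasoning

scale-≥ : ∀ k {c s} → 0 < k → c ℚ.* ι k ℚ.≤ s → c ℚ.≤ scale k s
scale-≥ (suc j) {c} {s} _ ck≤s = begin
  c                                      ≡⟨ sym (ℚP.*-identityʳ c) ⟩
  c ℚ.* 1ℚ                               ≡⟨ cong (c ℚ.*_) (sym (trans (ι*1/ (suc j) j) (n/n≡1 j))) ⟩
  c ℚ.* (ι (suc j) ℚ.* (+ 1 / suc j))    ≡⟨ sym (ℚP.*-assoc c (ι (suc j)) (+ 1 / suc j)) ⟩
  c ℚ.* ι (suc j) ℚ.* (+ 1 / suc j)      ≤⟨ ℚP.*-monoʳ-≤-nonNeg (+ 1 / suc j) {{ℚP.normalize-nonNeg 1 (suc j)}} ck≤s ⟩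
  s ℚ.* (+ 1 / suc j)                    ∎
  where open ℚP.≤-Reasoning

nonempty⇒∣p∣>0 : ∀ {n} {p : Subset n} → Nonempty p → 0 < ∣ p ∣
nonempty⇒∣p∣>0 {p = p} (x , x∈p) = ℕP.≤-<-trans z≤n (p∩q≢∅⇒∣p─q∣<∣p∣ p p (x , x∈p∩q⁺ (x∈p , x∈p)))

𝔼sub-≥ : ∀ {n} {S : Subset n} {c} {F : Fin n → ℚ} → Nonempty S →
  (∀ d → d ∈ S → c ℚ.≤ F d) → c ℚ.≤ 𝔼sub S F
𝔼sub-≥ {n} {S} {c} {F} ne c≤F = scale-≥ ∣ S ∣ (nonempty⇒∣p∣>0 ne)
  (subst (ℚ._≤ _) (sumFin-restrict-const S c) (sumFin-mono n restrict-mono))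
  where
  restrict-mono : ∀ d → (if lookup S d then c else 0ℚ) ℚ.≤ (if lookup S d then F d else 0ℚ)
  restrict-mono d with lookup S d in S[d]
  ... | true  = c≤F d (lookup⇒[]= d S S[d])
  ... | false = ℚP.≤-refl

toℕ-+ₚ : ∀ {p} .{{_ : NonZero p}} (x y : Fin p) → toℕ x ℕ.+ toℕ y < p → toℕ (x +ₚ y) ≡ toℕ x ℕ.+ toℕ y
toℕ-+ₚ x y x+y<p = trans (toℕ-fromℕ< _) (m<n⇒m%n≡m x+y<p)

indicator-nonNeg : ∀ b → 0ℚ ℚ.≤ (if b then 1ℚ else 0ℚ)
indicator-nonNeg true  = ℚP.nonNegative⁻¹ 1ℚ
indicator-nonNeg false = ℚP.≤-refl

1[N]-nonNeg : ∀ {p} N (x : Fin p) → 0ℚ ℚ.≤ 1[ N ] x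
1[N]-nonNeg N x = indicator-nonNeg _

1[N]-≡1 : ∀ {p} {N} (x : Fin p) → 1 ≤ toℕ x → toℕ x ≤ N → 1[ N ] x ≡ 1ℚ
1[N]-≡1 {N = N} x 1≤x x≤N with 1 ≤? toℕ x | toℕ x ≤? N
... | yes _    | yes _    = refl
... | no 1≰x   | _        = contradiction 1≤x 1≰x
... | yes _    | no x≰N   = contradiction x≤N x≰N

1[N]-on-progression : ∀ {p} .{{_ : NonZero p}} {N} (x d : Fin p) → N < p →
  1 ≤ toℕ x → toℕ x ℕ.+ toℕ d ℕ.+ toℕ d ≤ N →
  1[ N ] x ℚ.* 1[ N ] (x +ₚ d) ℚ.* 1[ N ] (x +ₚ d +ₚ d) ≡ 1ℚ
1[N]-on-progression {p} {N} x d N<p 1≤x x+2d≤N = cong₂ ℚ._*_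
  (cong₂ ℚ._*_ (1[N]-≡1 x 1≤x x≤N) (at (x +ₚ d) [x+d]≡x+d 1≤x+d x+d≤N))
  (at (x +ₚ d +ₚ d) [x+2d]≡x+2d (ℕP.≤-trans 1≤x+d (ℕP.m≤m+n _ (toℕ d))) x+2d≤N)
  where
  at : ∀ y {n} → toℕ y ≡ n → 1 ≤ n → n ≤ N → 1[ N ] y ≡ 1ℚ
  at y refl = 1[N]-≡1 y
  x+d≤N : toℕ x ℕ.+ toℕ d ≤ N
  x+d≤N = ℕP.≤-trans (ℕP.m≤m+n _ (toℕ d)) x+2d≤N
  x≤N : toℕ x ≤ N
  x≤N = ℕP.≤-trans (ℕP.m≤m+n _ (toℕ d)) x+d≤N
  1≤x+d : 1 ≤ toℕ x ℕ.+ toℕ d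
  1≤x+d = ℕP.≤-trans 1≤x (ℕP.m≤m+n _ (toℕ d))
  [x+d]≡x+d : toℕ (x +ₚ d) ≡ toℕ x ℕ.+ toℕ d
  [x+d]≡x+d = toℕ-+ₚ x d (ℕP.≤-<-trans x+d≤N N<p)
  [x+2d]≡x+2d : toℕ (x +ₚ d +ₚ d) ≡ toℕ x ℕ.+ toℕ d ℕ.+ toℕ d
  [x+2d]≡x+2d = trans
    (toℕ-+ₚ (x +ₚ d) d (subst (λ y → y ℕ.+ toℕ d < p) (sym [x+d]≡x+d) (ℕP.≤-<-trans x+2d≤N N<p)))
    (cong (ℕ._+ toℕ d) [x+d]≡x+d)

1[N]-progression-nonNeg : ∀ {p} .{{_ : NonZero p}} N (x d : Fin p) →
  0ℚ ℚ.≤ 1[ N ] x ℚ.* 1[ N ] (x +ₚ d) ℚ.* 1[ N ] (x +ₚ d +ₚ d)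
1[N]-progression-nonNeg N x d =
  *-nonNeg (*-nonNeg (1[N]-nonNeg N x) (1[N]-nonNeg N (x +ₚ d))) (1[N]-nonNeg N (x +ₚ d +ₚ d))

Λ₁-1[N]-≥ : ∀ N M q k (S : Subset (suc k)) → Nonempty S → (∀ d → d ∈ S → toℕ d ≤ q) →
  M ℕ.+ q ℕ.+ q ≤ N → N < suc k → ι M ℚ.* (+ 1 / suc k) ℚ.≤ Λ₁ S 1[ N ]
Λ₁-1[N]-≥ N M q k S ne S⊆[q] M+2q≤N N<p =
  ℚP.*-monoʳ-≤-nonNeg (+ 1 / suc k) {{ℚP.normalize-nonNeg 1 (suc k)}}
    (sumFin-≥-interval (suc k) 1 M
      (λ x → 𝔼sub-≥ ne (λ d _ → 1[N]-progression-nonNeg N x d))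
      (λ x 1≤x x<1+M → 𝔼sub-≥ ne (λ d d∈S →
        ℚP.≤-reflexive (sym (1[N]-on-progression x d N<p 1≤x (x+2d≤N x d (ℕP.≤-pred x<1+M) (S⊆[q] d d∈S))))))
      (s≤s (ℕP.≤-pred (ℕP.≤-<-trans M≤N N<p))))
  where
  x+2d≤N : ∀ (x d : Fin (suc k)) → toℕ x ≤ M → toℕ d ≤ q → toℕ x ℕ.+ toℕ d ℕ.+ toℕ d ≤ N
  x+2d≤N x d x≤M d≤q = ℕP.≤-trans (ℕP.+-mono-≤ (ℕP.+-mono-≤ x≤M d≤q) d≤q) M+2q≤N
  M≤N : M ≤ N
  M≤N = ℕP.≤-trans (ℕP.m≤m+n M (q ℕ.+ q)) (subst (_≤ N) (ℕP.+-assoc M q q) M+2q≤N)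

module _ (N : ℕ) where
  private
    q r : ℕ
    q = N ℕ./ 3
    r = N % 3

  third-split : (q ℕ.+ r) ℕ.+ q ℕ.+ q ≡ N
  third-split = trans (lem q r) (sym (m≡m%n+[m/n]*n N 3))
    where
    lem : ∀ q r → q ℕ.+ r ℕ.+ q ℕ.+ q ≡ r ℕ.+ q * 3
    lem = ℕ-solve-∀

  ≤-3*[third+rem] : N ≤ 3 * (q ℕ.+ r)
  ≤-3*[third+rem] = begin
    N                   ≡⟨ m≡m%n+[m/n]*n N 3 ⟩
    r ℕ.+ q * 3         ≤⟨ ℕP.m≤m+n _ (2 * r) ⟩
    r ℕ.+ q * 3 ℕ.+ 2 * r ≡⟨ lem q r ⟩
    3 * (q ℕ.+ r)       ∎
    where
    open ℕP.≤-Reasoning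
    lem : ∀ q r → r ℕ.+ q * 3 ℕ.+ 2 * r ≡ 3 * (q ℕ.+ r)
    lem = ℕ-solve-∀

3*d≤N⇒d≤N/3 : ∀ {d N} → 3 * d ≤ N → d ≤ N ℕ./ 3
3*d≤N⇒d≤N/3 {d} {N} 3d≤N =
  subst (_≤ N ℕ./ 3) (m*n/n≡m d 3) (/-monoˡ-≤ 3 (subst (_≤ N) (ℕP.*-comm 3 d) 3d≤N))

lemma4p3 : (N p : ℕ) .{{_ : NonZero p}} → 3 ≤ N → Prime p → 3 * N < p → p < 6 * N →
    (S : Subset p) → Nonempty S → (∀ d → d ∈ S → 1 ≤ toℕ d × 3 * toℕ d ≤ N) →
    (+ 1 / 18) ℚ.< Λ₁ S 1[ N ]
lemma4p3 N zero    _ _ ()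
lemma4p3 N (suc k) _ _ 3N<p p<6N S ne S⊆[N/3] = begin-strict
  + 1 / 18                <⟨ 1/a<m/n 17 M k p<18M ⟩
  + M / suc k             ≡⟨ sym (ι*1/ M k) ⟩
  ι M ℚ.* (+ 1 / suc k)   ≤⟨ Λ₁-1[N]-≥ N M q k S ne (λ d d∈S → 3*d≤N⇒d≤N/3 (proj₂ (S⊆[N/3] d d∈S)))
                               (ℕP.≤-reflexive (third-split N)) N<p ⟩
  Λ₁ S 1[ N ]             ∎
  where
  open ℚP.≤-Reasoning
  q M : ℕ
  q = N ℕ./ 3
  M = q ℕ.+ N % 3
  N<p : N < suc k
  N<p = ℕP.≤-<-trans (ℕP.m≤n*m N 3) 3N<p
  p<18M : suc k < 18 * M
  p<18M = ℕP.<-≤-trans p<6N (ℕP.≤-trans (ℕP.*-monoʳ-≤ 6 (≤-3*[third+rem] N)) (ℕP.≤-reflexive (sym (ℕP.*-assoc 6 3 M))))
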